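{- Let $n \ge 2$, $w \in \mathfrak{S}_n$ and $k \in [1,n-1]$. Then $$\min\nolimits_k(w) = \Big| \big\{w(1),\ldots,w(k)\big\} \cap \big\{k+1,\ldots, n\big\} \Big| \;\Big(= \Big| \big\{w(k+1),\ldots,w(n)\big\} \cap \big\{1,\ldots, k\big\} \Big|\Big).$$
   Context: $\mathfrak{S}_n$ is the symmetric group on $[1,n]$, and $\sigma_i$ ($1\le i\le n-1$) is the simple reflection (adjacent transposition) exchanging $i$ and $i+1$. A reduced decomposition of $w$ is an expression of $w$ as a product of simple reflections with the minimum possible number of factors (the length $\ell(w)$). For $k\in[1,n-1]$, $\min_k(w)$ denotes the minimum, over all reduced decompositions of $w$, of the number of times $\sigma_k$ appears as a factor, and $\max_k(w)$ the corresponding maximum. -}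

module Defs where

open import Data.Nat using (ℕ; zero; suc; _≤_; _<_; _≤?_; _<?_)
open import Data.Fin using (Fin; toℕ; inject₁; suc; _≟_)
open import Data.Fin.Permutation using (Permutation′; _⟨$⟩ʳ_)
import Data.Fin.Permutation.Components as PC
open import Data.List using (List; []; _∷_; length; filter; allFin)
open import Data.Product using (Σ; _×_; _,_)
open import Relation.Binary.PropositionalEquality using (_≡_)
open import Relation.Nullary.Decidable using (_×-dec_)

-- Conventions: 𝔖ₙ with n = suc m acts on Fin (suc m); the element x : Fin n
-- stands for the paper's point toℕ x + 1.  A letter i : Fin m stands for the
-- simple reflection σ_{toℕ i + 1}, exchanging (0-based) points i and i+1.

σ : ∀ {m} → Fin m → Fin (suc m) → Fin (suc m)
σ i = PC.transpose (inject₁ i) (suc i)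

Word : ℕ → Set
Word m = List (Fin m)

-- the product σ_{i₁} σ_{i₂} ⋯ σ_{i_r} (composition of maps, rightmost first)
eval : ∀ {m} → Word m → Fin (suc m) → Fin (suc m)
eval [] x = x
eval (i ∷ is) x = σ i (eval is x)

Represents : ∀ {m} → Permutation′ (suc m) → Word m → Set
Represents w ws = ∀ x → eval ws x ≡ w ⟨$⟩ʳ x

Reduced : ∀ {m} → Permutation′ (suc m) → Word m → Set
Reduced w ws = Represents w ws × (∀ vs → Represents w vs → length ws ≤ length vs)

occ : ∀ {m} → Fin m → Word m → ℕ
occ k ws = length (filter (λ i → i ≟ k) ws)

IsMinK : ∀ {m} → Permutation′ (suc m) → Fin m → ℕ → Set
IsMinK w k c =
  Σ (Word _) (λ ws → Reduced w ws × occ k ws ≡ c)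
  × (∀ ws → Reduced w ws → c ≤ occ k ws)

-- |{w(1),…,w(k)} ∩ {k+1,…,n}| = #{ j ≤ k : w(j) > k } (1-based; w injective)
crossCount : ∀ {m} → Permutation′ (suc m) → Fin m → ℕ
crossCount {m} w k =
  length (filter (λ j → (toℕ j <? suc (toℕ k)) ×-dec (suc (toℕ k) ≤? toℕ (w ⟨$⟩ʳ j)))
                 (allFin (suc m)))

module Submission where

-- Write cross_k(π) for the right-hand side and inv(π) for the number of
-- inversions of π; σ_i π exchanges the VALUES i and i+1 of π.
--
-- Left multiplication by σ_i changes inv by exactly one, and
-- changes cross_k by at most one if i = k and not at all otherwise.  Since
-- both vanish at the identity, every decomposition ws of w has
-- inv(w) ≤ length ws and cross_k(w) ≤ #(σ_k in ws).
--
-- If π ≠ id it has a left descent (value i+1 stands left of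
-- value i) which is admissible: either i ≠ k, or i = k and the descent
-- straddles k (value k+1 sits among the first k+1 positions, value k does
-- not).  Peeling off admissible descents lowers inv by one at every step and
-- spends a letter σ_k only when cross_k drops, giving a decomposition with
-- inv(w) letters and at most cross_k(w) letters σ_k.  It is reduced by the
-- lower bound, and its σ_k-count is then exactly cross_k(w).

open import Defs
open import Data.Nat
  using (ℕ; zero; suc; _+_; _*_; _∸_; _≤_; _<_; z≤n; s≤s; s≤s⁻¹)
open import Data.Nat.Properties
open import Data.Bool using (true; false; if_then_else_)
open import Data.Fin using (Fin; toℕ; inject₁; fromℕ<)
  renaming (zero to fzero; suc to fsuc)
open import Data.Fin.Properties
  using (toℕ-injective; toℕ-inject₁; toℕ-fromℕ<; toℕ<n)
  renaming (_≟_ to _≟ᶠ_)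
open import Data.Fin.Permutation
  using (Permutation′; _⟨$⟩ʳ_; _⟨$⟩ˡ_; inverseˡ; inverseʳ; _∘ₚ_; transpose; id; flip;
         lift₀-transpose)
open import Data.List using ([]; _∷_; length; filter; tabulate)
open import Data.Product using (Σ; _×_; _,_; proj₁)
open import Data.Sum using (_⊎_; inj₁; inj₂)
open import Data.Empty using (⊥-elim)
open import Function using (_∘_)
open import Relation.Nullary using (Dec; yes; no; ¬_; does; contradiction)
open import Relation.Nullary.Decidable using (_×-dec_; ¬?)
open import Relation.Unary using (Pred; Decidable)
open import Relation.Binary.PropositionalEquality
open import Algebra.Properties.Semiring.Sum +-*-semiring
  using (sum-syntax; sum-cong-≗; ∑-distrib-+; *-distribˡ-sum; sum-replicate-zero; ∑-permute)

𝟙[_] : ∀ {p} {P : Set p} → Dec P → ℕ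
𝟙[ d ] = if does d then 1 else 0

𝟙-yes : ∀ {p} {P : Set p} (d : Dec P) → P → 𝟙[ d ] ≡ 1
𝟙-yes (yes _) _ = refl
𝟙-yes (no ¬p) p = contradiction p ¬p

𝟙-no : ∀ {p} {P : Set p} (d : Dec P) → ¬ P → 𝟙[ d ] ≡ 0
𝟙-no (yes p) ¬p = contradiction p ¬p
𝟙-no (no _) _ = refl

𝟙≤1 : ∀ {p} {P : Set p} (d : Dec P) → 𝟙[ d ] ≤ 1
𝟙≤1 (yes _) = s≤s z≤n
𝟙≤1 (no _) = z≤n

𝟙-× : ∀ {p q} {P : Set p} {Q : Set q} (d : Dec P) (e : Dec Q) →
      𝟙[ d ×-dec e ] ≡ 𝟙[ d ] * 𝟙[ e ]
𝟙-× (yes _) (yes _) = refl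
𝟙-× (yes _) (no _) = refl
𝟙-× (no _) _ = refl

𝟙-exclusive : ∀ {p q} {P : Set p} {Q : Set q} (d : Dec P) (e : Dec Q) →
              (P → ¬ Q) → 𝟙[ d ] * 𝟙[ e ] ≡ 0
𝟙-exclusive (yes p) e excl = trans (+-identityʳ 𝟙[ e ]) (𝟙-no e (excl p))
𝟙-exclusive (no _) _ _ = refl

balance-≤ : ∀ {a b x y} → a + x ≡ b + y → x ≤ 1 → b ≤ suc a
balance-≤ {a} {b} {x} {y} a+x≡b+y x≤1 = begin
  b      ≤⟨ m≤m+n b y ⟩
  b + y  ≡⟨ sym a+x≡b+y ⟩
  a + x  ≤⟨ +-monoʳ-≤ a x≤1 ⟩
  a + 1  ≡⟨ +-comm a 1 ⟩
  suc a  ∎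
  where open ≤-Reasoning

balance-exact : ∀ {a b x y} → a + x ≡ b + y → x ≡ 0 → y ≡ 1 → a ≡ suc b
balance-exact {a} {b} a+0≡b+1 refl refl =
  trans (sym (+-identityʳ a)) (trans a+0≡b+1 (+-comm b 1))

weighted : ∀ t {a b c d} → a + b ≡ c + d → t * a + t * b ≡ t * c + t * d
weighted t {a} {b} {c} {d} a+b≡c+d = begin
  t * a + t * b  ≡⟨ *-distribˡ-+ t a b ⟨
  t * (a + b)    ≡⟨ cong (t *_) a+b≡c+d ⟩
  t * (c + d)    ≡⟨ *-distribˡ-+ t c d ⟩
  t * c + t * d  ∎
  where open ≡-Reasoning

∑-zero : ∀ {n} {f : Fin n → ℕ} → (∀ x → f x ≡ 0) → ∑[ x < n ] f x ≡ 0
∑-zero {n} f≗0 = trans (sum-cong-≗ f≗0) (sum-replicate-zero n)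

∑∑-cong : ∀ {n} {F G : Fin n → Fin n → ℕ} → (∀ x y → F x y ≡ G x y) →
  ∑[ x < n ] ∑[ y < n ] F x y ≡ ∑[ x < n ] ∑[ y < n ] G x y
∑∑-cong F≗G = sum-cong-≗ (λ x → sum-cong-≗ (F≗G x))

∑∑-distrib-+ : ∀ {n} (F G : Fin n → Fin n → ℕ) →
  ∑[ x < n ] ∑[ y < n ] (F x y + G x y)
  ≡ ∑[ x < n ] ∑[ y < n ] F x y + ∑[ x < n ] ∑[ y < n ] G x y
∑∑-distrib-+ {n} F G =
  trans (sum-cong-≗ (λ x → ∑-distrib-+ (F x) (G x)))
        (∑-distrib-+ (λ x → ∑[ y < n ] F x y) (λ x → ∑[ y < n ] G x y))

∑-pick : ∀ {n} (p : Fin n) (h : Fin n → ℕ) → ∑[ x < n ] (𝟙[ toℕ x ≟ toℕ p ] * h x) ≡ h p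
∑-pick {suc n} fzero h =
  trans (cong₂ _+_ (+-identityʳ (h fzero)) (sum-replicate-zero n)) (+-identityʳ _)
∑-pick (fsuc p) h = ∑-pick p (h ∘ fsuc)

-- Summing against the indicator of "π takes the value a" evaluates at π⁻¹(a);
-- this is ∑-pick after reindexing the sum along π⁻¹.
∑-at-value : ∀ {N} (π : Permutation′ N) (a : Fin N) (c : Fin N → ℕ) →
  ∑[ x < N ] (𝟙[ toℕ (π ⟨$⟩ʳ x) ≟ toℕ a ] * c x) ≡ c (π ⟨$⟩ˡ a)
∑-at-value {N} π a c = begin
  ∑[ x < N ] (𝟙[ toℕ (π ⟨$⟩ʳ x) ≟ toℕ a ] * c x)
    ≡⟨ ∑-permute _ (flip π) ⟩
  ∑[ u < N ] (𝟙[ toℕ (π ⟨$⟩ʳ (π ⟨$⟩ˡ u)) ≟ toℕ a ] * c (π ⟨$⟩ˡ u))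
    ≡⟨ sum-cong-≗ (λ u → cong (λ v → 𝟙[ toℕ v ≟ toℕ a ] * c (π ⟨$⟩ˡ u)) (inverseʳ π)) ⟩
  ∑[ u < N ] (𝟙[ toℕ u ≟ toℕ a ] * c (π ⟨$⟩ˡ u))
    ≡⟨ ∑-pick a (c ∘ (π ⟨$⟩ˡ_)) ⟩
  c (π ⟨$⟩ˡ a) ∎
  where open ≡-Reasoning

∑∑-at-values : ∀ {N} (π : Permutation′ N) (a b : Fin N) (c : Fin N → Fin N → ℕ) →
  ∑[ x < N ] ∑[ y < N ]
    (c x y * (𝟙[ toℕ (π ⟨$⟩ʳ x) ≟ toℕ a ] * 𝟙[ toℕ (π ⟨$⟩ʳ y) ≟ toℕ b ]))
  ≡ c (π ⟨$⟩ˡ a) (π ⟨$⟩ˡ b)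
∑∑-at-values {N} π a b c = trans (sum-cong-≗ inner) (∑-at-value π a (λ x → c x (π ⟨$⟩ˡ b)))
  where
  open ≡-Reasoning
  E : Fin N → Fin N → ℕ
  E v x = 𝟙[ toℕ (π ⟨$⟩ʳ x) ≟ toℕ v ]
  inner : ∀ x → ∑[ y < N ] (c x y * (E a x * E b y)) ≡ E a x * c x (π ⟨$⟩ˡ b)
  inner x = begin
    ∑[ y < N ] (c x y * (E a x * E b y))
      ≡⟨ sum-cong-≗ (λ y → trans (*-comm (c x y) _) (*-assoc (E a x) (E b y) (c x y))) ⟩
    ∑[ y < N ] (E a x * (E b y * c x y))
      ≡⟨ *-distribˡ-sum (E a x) (λ y → E b y * c x y) ⟨
    E a x * ∑[ y < N ] (E b y * c x y)
      ≡⟨ cong (E a x *_) (∑-at-value π b (c x)) ⟩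
    E a x * c x (π ⟨$⟩ˡ b) ∎

count-tabulate : ∀ {n p} {A : Set} {P : Pred A p} (P? : Decidable P) (g : Fin n → A) →
  length (filter P? (tabulate g)) ≡ ∑[ x < n ] 𝟙[ P? (g x) ]
count-tabulate {zero} P? g = refl
count-tabulate {suc n} P? g with does (P? (g fzero))
... | true = cong suc (count-tabulate P? (g ∘ fsuc))
... | false = count-tabulate P? (g ∘ fsuc)

-- The transposition of i and i+1 acting on ℕ.
swap : ℕ → ℕ → ℕ
swap zero    zero          = 1
swap zero    (suc zero)    = 0
swap zero    (suc (suc u)) = suc (suc u)
swap (suc i) zero          = zero
swap (suc i) (suc u)       = suc (swap i u)

swap-involutive : ∀ i u → swap i (swap i u) ≡ u
swap-involutive zero zero = refl
swap-involutive zero (suc zero) = refl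
swap-involutive zero (suc (suc u)) = refl
swap-involutive (suc i) zero = refl
swap-involutive (suc i) (suc u) = cong suc (swap-involutive i u)

-- swap i preserves the order of two values unless they are {i, i+1}, where it
-- reverses it.  In balance form, for values U (left) and V (right):
swap-inversion : ∀ I U V →
  𝟙[ V <? U ] + 𝟙[ U ≟ I ] * 𝟙[ V ≟ suc I ]
  ≡ 𝟙[ swap I V <? swap I U ] + 𝟙[ U ≟ suc I ] * 𝟙[ V ≟ I ]
swap-inversion zero zero zero = refl
swap-inversion zero zero (suc zero) = refl
swap-inversion zero zero (suc (suc V)) = refl
swap-inversion zero (suc zero) zero = refl
swap-inversion zero (suc zero) (suc zero) = refl
swap-inversion zero (suc zero) (suc (suc V)) = refl
swap-inversion zero (suc (suc U)) zero = refl
swap-inversion zero (suc (suc U)) (suc zero) = refl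
swap-inversion zero (suc (suc U)) (suc (suc V)) = refl
swap-inversion (suc I) zero V = refl
swap-inversion (suc I) (suc U) zero =
  cong suc (trans (*-zeroʳ 𝟙[ U ≟ I ]) (sym (*-zeroʳ 𝟙[ U ≟ suc I ])))
swap-inversion (suc I) (suc U) (suc V) = swap-inversion I U V

-- swap K moves a value across the threshold K+1 exactly when it is K or K+1.
swap-crossing : ∀ K V →
  𝟙[ suc K ≤? V ] + 𝟙[ V ≟ K ] ≡ 𝟙[ suc K ≤? swap K V ] + 𝟙[ V ≟ suc K ]
swap-crossing zero zero = refl
swap-crossing zero (suc zero) = refl
swap-crossing zero (suc (suc V)) = refl
swap-crossing (suc K) zero = refl
swap-crossing (suc K) (suc V) = swap-crossing K V

swap-noncrossing : ∀ I K V → I ≢ K → 𝟙[ suc K ≤? swap I V ] ≡ 𝟙[ suc K ≤? V ]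
swap-noncrossing zero zero V I≢K = ⊥-elim (I≢K refl)
swap-noncrossing zero (suc K) zero _ = refl
swap-noncrossing zero (suc K) (suc zero) _ = refl
swap-noncrossing zero (suc K) (suc (suc V)) _ = refl
swap-noncrossing (suc I) zero zero _ = refl
swap-noncrossing (suc I) zero (suc V) _ = refl
swap-noncrossing (suc I) (suc K) zero _ = refl
swap-noncrossing (suc I) (suc K) (suc V) I≢K = swap-noncrossing I K V (I≢K ∘ cong suc)

toℕ-σ : ∀ {m} (i : Fin m) (x : Fin (suc m)) → toℕ (σ i x) ≡ swap (toℕ i) (toℕ x)
toℕ-σ fzero fzero = refl
toℕ-σ fzero (fsuc fzero) = refl
toℕ-σ fzero (fsuc (fsuc x)) = refl
toℕ-σ (fsuc i) fzero = refl
toℕ-σ (fsuc i) (fsuc x) =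
  trans (cong toℕ (lift₀-transpose (inject₁ i) (fsuc i) (fsuc x))) (cong suc (toℕ-σ i x))

σ-involutive : ∀ {m} (i : Fin m) (x : Fin (suc m)) → σ i (σ i x) ≡ x
σ-involutive i x = toℕ-injective (begin
  toℕ (σ i (σ i x))              ≡⟨ toℕ-σ i (σ i x) ⟩
  swap (toℕ i) (toℕ (σ i x))     ≡⟨ cong (swap (toℕ i)) (toℕ-σ i x) ⟩
  swap (toℕ i) (swap (toℕ i) (toℕ x)) ≡⟨ swap-involutive (toℕ i) (toℕ x) ⟩
  toℕ x                          ∎)
  where open ≡-Reasoning

reflection : ∀ {m} → Fin m → Permutation′ (suc m)
reflection i = transpose (inject₁ i) (fsuc i)

perm : ∀ {m} → Word m → Permutation′ (suc m)
perm [] = id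
perm (i ∷ is) = perm is ∘ₚ reflection i

perm-eval : ∀ {m} (ws : Word m) x → perm ws ⟨$⟩ʳ x ≡ eval ws x
perm-eval [] x = refl
perm-eval (i ∷ is) x = cong (σ i) (perm-eval is x)

represented-by-perm : ∀ {m} {π : Permutation′ (suc m)} ws →
  Represents π ws → ∀ x → π ⟨$⟩ʳ x ≡ perm ws ⟨$⟩ʳ x
represented-by-perm ws rep x = trans (sym (rep x)) (sym (perm-eval ws x))

occ-cons : ∀ {m} (k i : Fin m) is → occ k (i ∷ is) ≡ 𝟙[ i ≟ᶠ k ] + occ k is
occ-cons k i is with does (i ≟ᶠ k)
... | true = refl
... | false = refl

module _ {N : ℕ} where
  inversions : (Fin N → Fin N) → ℕ
  inversions f = ∑[ x < N ] ∑[ y < N ] (𝟙[ toℕ x <? toℕ y ] * 𝟙[ toℕ (f y) <? toℕ (f x) ])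

  inversions-cong : ∀ {f g : Fin N → Fin N} → (∀ x → f x ≡ g x) → inversions f ≡ inversions g
  inversions-cong f≗g = sum-cong-≗ (λ x → sum-cong-≗ (λ y →
    cong₂ (λ u v → 𝟙[ toℕ x <? toℕ y ] * 𝟙[ toℕ u <? toℕ v ]) (f≗g y) (f≗g x)))

  inversions-id : inversions (λ x → x) ≡ 0
  inversions-id = ∑-zero {N} (λ x → ∑-zero {N} (λ y →
    𝟙-exclusive (toℕ x <? toℕ y) (toℕ y <? toℕ x) <-asym))

-- Left multiplication by σ_i flips exactly the status of the pair of
-- positions holding the values i and i+1.
module _ {m : ℕ} (π : Permutation′ (suc m)) (i : Fin m) where
  private
    f = π ⟨$⟩ʳ_
    P = π ⟨$⟩ˡ_
    a = inject₁ i
    b = fsuc i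

  inversions-step : inversions f + 𝟙[ toℕ (P a) <? toℕ (P b) ]
                  ≡ inversions (σ i ∘ f) + 𝟙[ toℕ (P b) <? toℕ (P a) ]
  inversions-step = begin
    inversions f + T (P a) (P b)
      ≡⟨ cong (inversions f +_) (∑∑-at-values π a b T) ⟨
    inversions f + ∑[ x < suc m ] ∑[ y < suc m ] (T x y * (E a x * E b y))
      ≡⟨ ∑∑-distrib-+ (λ x y → T x y * 𝟙[ toℕ (f y) <? toℕ (f x) ])
                      (λ x y → T x y * (E a x * E b y)) ⟨
    ∑[ x < suc m ] ∑[ y < suc m ] (T x y * 𝟙[ toℕ (f y) <? toℕ (f x) ] + T x y * (E a x * E b y))
      ≡⟨ ∑∑-cong flip-pair ⟩
    ∑[ x < suc m ] ∑[ y < suc m ]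
        (T x y * 𝟙[ toℕ (σ i (f y)) <? toℕ (σ i (f x)) ] + T x y * (E b x * E a y))
      ≡⟨ ∑∑-distrib-+ (λ x y → T x y * 𝟙[ toℕ (σ i (f y)) <? toℕ (σ i (f x)) ])
                      (λ x y → T x y * (E b x * E a y)) ⟩
    inversions (σ i ∘ f) + ∑[ x < suc m ] ∑[ y < suc m ] (T x y * (E b x * E a y))
      ≡⟨ cong (inversions (σ i ∘ f) +_) (∑∑-at-values π b a T) ⟩
    inversions (σ i ∘ f) + T (P b) (P a) ∎
    where
    open ≡-Reasoning
    T : Fin (suc m) → Fin (suc m) → ℕ
    T x y = 𝟙[ toℕ x <? toℕ y ]
    E : Fin (suc m) → Fin (suc m) → ℕ
    E v x = 𝟙[ toℕ (f x) ≟ toℕ v ]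
    flip-pair : ∀ x y → T x y * 𝟙[ toℕ (f y) <? toℕ (f x) ] + T x y * (E a x * E b y)
                      ≡ T x y * 𝟙[ toℕ (σ i (f y)) <? toℕ (σ i (f x)) ] + T x y * (E b x * E a y)
    flip-pair x y rewrite toℕ-σ i (f x) | toℕ-σ i (f y) | toℕ-inject₁ i =
      weighted (T x y) (swap-inversion (toℕ i) (toℕ (f x)) (toℕ (f y)))

  inversions-reflection-≤ : inversions (σ i ∘ f) ≤ suc (inversions f)
  inversions-reflection-≤ = balance-≤ inversions-step (𝟙≤1 (toℕ (P a) <? toℕ (P b)))

  inversions-descent : toℕ (P b) < toℕ (P a) → inversions f ≡ suc (inversions (σ i ∘ f))
  inversions-descent desc = balance-exact inversions-step
    (𝟙-no (toℕ (P a) <? toℕ (P b)) (<-asym desc)) (𝟙-yes (toℕ (P b) <? toℕ (P a)) desc)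

module _ {m : ℕ} (k : Fin m) where
  private
    K = toℕ k

  crossings : (Fin (suc m) → Fin (suc m)) → ℕ
  crossings f = ∑[ x < suc m ] (𝟙[ toℕ x <? suc K ] * 𝟙[ suc K ≤? toℕ (f x) ])

  crossings-cong : ∀ {f g} → (∀ x → f x ≡ g x) → crossings f ≡ crossings g
  crossings-cong f≗g = sum-cong-≗ (λ x →
    cong (λ u → 𝟙[ toℕ x <? suc K ] * 𝟙[ suc K ≤? toℕ u ]) (f≗g x))

  crossings-id : crossings (λ x → x) ≡ 0
  crossings-id = ∑-zero {suc m} (λ x →
    𝟙-exclusive (toℕ x <? suc K) (suc K ≤? toℕ x) (λ x<1+K 1+K≤x → <⇒≱ x<1+K 1+K≤x))

  -- σ_i with i ≠ k keeps every value on its side of the threshold k+1.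
  crossings-other : ∀ i → i ≢ k → ∀ f → crossings (σ i ∘ f) ≡ crossings f
  crossings-other i i≢k f = sum-cong-≗ (λ x → cong (𝟙[ toℕ x <? suc K ] *_) (begin
    𝟙[ suc K ≤? toℕ (σ i (f x)) ]     ≡⟨ cong (λ u → 𝟙[ suc K ≤? u ]) (toℕ-σ i (f x)) ⟩
    𝟙[ suc K ≤? swap (toℕ i) (toℕ (f x)) ] ≡⟨ swap-noncrossing (toℕ i) K (toℕ (f x)) I≢K ⟩
    𝟙[ suc K ≤? toℕ (f x) ]           ∎))
    where
    open ≡-Reasoning
    I≢K : toℕ i ≢ K
    I≢K = i≢k ∘ toℕ-injective

  -- σ_k moves the values k and k+1 across the threshold: the crossing count
  -- changes according to where π puts these two values.
  crossings-step : ∀ (π : Permutation′ (suc m)) →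
    crossings (π ⟨$⟩ʳ_) + 𝟙[ toℕ (π ⟨$⟩ˡ inject₁ k) <? suc K ]
    ≡ crossings (σ k ∘ (π ⟨$⟩ʳ_)) + 𝟙[ toℕ (π ⟨$⟩ˡ fsuc k) <? suc K ]
  crossings-step π = begin
    crossings f + A (π ⟨$⟩ˡ a)
      ≡⟨ cong (crossings f +_) (∑-at-value π a A) ⟨
    crossings f + ∑[ x < suc m ] (E a x * A x)
      ≡⟨ cong (crossings f +_) (sum-cong-≗ (λ x → *-comm (E a x) (A x))) ⟩
    crossings f + ∑[ x < suc m ] (A x * E a x)
      ≡⟨ ∑-distrib-+ (λ x → A x * 𝟙[ suc K ≤? toℕ (f x) ]) (λ x → A x * E a x) ⟨
    ∑[ x < suc m ] (A x * 𝟙[ suc K ≤? toℕ (f x) ] + A x * E a x)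
      ≡⟨ sum-cong-≗ cross ⟩
    ∑[ x < suc m ] (A x * 𝟙[ suc K ≤? toℕ (σ k (f x)) ] + A x * E b x)
      ≡⟨ ∑-distrib-+ (λ x → A x * 𝟙[ suc K ≤? toℕ (σ k (f x)) ]) (λ x → A x * E b x) ⟩
    crossings (σ k ∘ f) + ∑[ x < suc m ] (A x * E b x)
      ≡⟨ cong (crossings (σ k ∘ f) +_) (sum-cong-≗ (λ x → *-comm (A x) (E b x))) ⟩
    crossings (σ k ∘ f) + ∑[ x < suc m ] (E b x * A x)
      ≡⟨ cong (crossings (σ k ∘ f) +_) (∑-at-value π b A) ⟩
    crossings (σ k ∘ f) + A (π ⟨$⟩ˡ b) ∎
    where
    open ≡-Reasoning
    f = π ⟨$⟩ʳ_
    a = inject₁ k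
    b = fsuc k
    A : Fin (suc m) → ℕ
    A x = 𝟙[ toℕ x <? suc K ]
    E : Fin (suc m) → Fin (suc m) → ℕ
    E v x = 𝟙[ toℕ (f x) ≟ toℕ v ]
    cross : ∀ x → A x * 𝟙[ suc K ≤? toℕ (f x) ] + A x * E a x
                ≡ A x * 𝟙[ suc K ≤? toℕ (σ k (f x)) ] + A x * E b x
    cross x rewrite toℕ-σ k (f x) | toℕ-inject₁ k = weighted (A x) (swap-crossing K (toℕ (f x)))

  crossings-reflection-≤ : ∀ (π : Permutation′ (suc m)) i →
    crossings (σ i ∘ (π ⟨$⟩ʳ_)) ≤ 𝟙[ i ≟ᶠ k ] + crossings (π ⟨$⟩ʳ_)
  crossings-reflection-≤ π i with i ≟ᶠ k
  ... | yes refl = balance-≤ (crossings-step π) (𝟙≤1 (toℕ (π ⟨$⟩ˡ inject₁ k) <? suc K))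
  ... | no i≢k = ≤-reflexive (crossings-other i i≢k (π ⟨$⟩ʳ_))

inversions-≤-length : ∀ {m} (ws : Word m) → inversions (perm ws ⟨$⟩ʳ_) ≤ length ws
inversions-≤-length {m} [] = ≤-reflexive (inversions-id {suc m})
inversions-≤-length (i ∷ is) =
  ≤-trans (inversions-reflection-≤ (perm is) i) (s≤s (inversions-≤-length is))

crossings-≤-occ : ∀ {m} (k : Fin m) (ws : Word m) → crossings k (perm ws ⟨$⟩ʳ_) ≤ occ k ws
crossings-≤-occ k [] = ≤-reflexive (crossings-id k)
crossings-≤-occ k (i ∷ is) = begin
  crossings k (σ i ∘ (perm is ⟨$⟩ʳ_))       ≤⟨ crossings-reflection-≤ k (perm is) i ⟩
  𝟙[ i ≟ᶠ k ] + crossings k (perm is ⟨$⟩ʳ_) ≤⟨ +-monoʳ-≤ 𝟙[ i ≟ᶠ k ] (crossings-≤-occ k is) ⟩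
  𝟙[ i ≟ᶠ k ] + occ k is                    ≡⟨ occ-cons k i is ⟨
  occ k (i ∷ is)                             ∎
  where open ≤-Reasoning

length-lower-bound : ∀ {m} {π : Permutation′ (suc m)} ws →
  Represents π ws → inversions (π ⟨$⟩ʳ_) ≤ length ws
length-lower-bound {π = π} ws rep =
  ≤-trans (≤-reflexive (inversions-cong (represented-by-perm {π = π} ws rep))) (inversions-≤-length ws)

occ-lower-bound : ∀ {m} (k : Fin m) {π : Permutation′ (suc m)} ws →
  Represents π ws → crossings k (π ⟨$⟩ʳ_) ≤ occ k ws
occ-lower-bound k {π} ws rep =
  ≤-trans (≤-reflexive (crossings-cong k (represented-by-perm {π = π} ws rep))) (crossings-≤-occ k ws)

Ascending : (ℕ → ℕ) → ℕ → ℕ → Set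
Ascending Q a b = ∀ t → a ≤ t → t < b → Q t < Q (suc t)

module _ {Q : ℕ → ℕ} {a b : ℕ} (asc : Ascending Q a b) where

  ascending-gap : ∀ {i} d → a ≤ i → i + d ≤ b → Q i + d ≤ Q (i + d)
  ascending-gap {i} zero _ _ = ≤-reflexive (trans (+-identityʳ (Q i)) (cong Q (sym (+-identityʳ i))))
  ascending-gap {i} (suc d) a≤i i+1+d≤b = begin
    Q i + suc d      ≡⟨ +-suc (Q i) d ⟩
    suc (Q i + d)    ≤⟨ s≤s (ascending-gap d a≤i (≤-trans (n≤1+n (i + d)) i+d<b)) ⟩
    suc (Q (i + d))  ≤⟨ asc (i + d) (≤-trans a≤i (m≤m+n i d)) i+d<b ⟩
    Q (suc (i + d))  ≡⟨ cong Q (+-suc i d) ⟨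
    Q (i + suc d)    ∎
    where
    open ≤-Reasoning
    i+d<b : i + d < b
    i+d<b = subst (_≤ b) (+-suc i d) i+1+d≤b

  ascending-lower : a ≤ Q a → ∀ {j} → a ≤ j → j ≤ b → j ≤ Q j
  ascending-lower a≤Qa {j} a≤j j≤b = begin
    j                ≡⟨ m+[n∸m]≡n a≤j ⟨
    a + (j ∸ a)      ≤⟨ +-monoˡ-≤ (j ∸ a) a≤Qa ⟩
    Q a + (j ∸ a)    ≤⟨ ascending-gap (j ∸ a) ≤-refl (subst (_≤ b) (sym (m+[n∸m]≡n a≤j)) j≤b) ⟩
    Q (a + (j ∸ a))  ≡⟨ cong Q (m+[n∸m]≡n a≤j) ⟩
    Q j              ∎
    where open ≤-Reasoning

  ascending-upper : Q b ≤ b → ∀ {j} → a ≤ j → j ≤ b → Q j ≤ j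
  ascending-upper Qb≤b {j} a≤j j≤b = +-cancelʳ-≤ (b ∸ j) (Q j) j (begin
    Q j + (b ∸ j)    ≤⟨ ascending-gap (b ∸ j) a≤j (≤-reflexive (m+[n∸m]≡n j≤b)) ⟩
    Q (j + (b ∸ j))  ≡⟨ cong Q (m+[n∸m]≡n j≤b) ⟩
    Q b              ≤⟨ Qb≤b ⟩
    b                ≡⟨ m+[n∸m]≡n j≤b ⟨
    j + (b ∸ j)      ∎)
    where open ≤-Reasoning

  ascending-fixes : a ≤ Q a → Q b ≤ b → ∀ {j} → a ≤ j → j ≤ b → Q j ≡ j
  ascending-fixes lo hi a≤j j≤b =
    ≤-antisym (ascending-upper hi a≤j j≤b) (ascending-lower lo a≤j j≤b)

module _ (Q : ℕ → ℕ) {m K : ℕ} (K<m : K < m)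
         (bounded : ∀ j → j ≤ m → Q j ≤ m)
         (injective : ∀ {i j} → i ≤ m → j ≤ m → Q i ≡ Q j → i ≡ j) where

  ascends : ∀ t → t < m → ¬ (Q (suc t) < Q t) → Q t < Q (suc t)
  ascends t t<m ¬desc = ≤∧≢⇒< (≮⇒≥ ¬desc) (λ e → 1+n≢n (sym (injective (<⇒≤ t<m) t<m e)))

  lone-descent-straddles : (∀ t → t < m → t ≢ K → Q t < Q (suc t)) → Q (suc K) < Q K →
                           Q (suc K) ≤ K × K < Q K
  lone-descent-straddles ascent desc = s≤s⁻¹ Q[1+K]<1+K , K<QK
    where
    below : Ascending Q 0 K
    below t _ t<K = ascent t (<-trans t<K K<m) (<⇒≢ t<K)
    above : Ascending Q (suc K) m
    above t K<t t<m = ascent t t<m (λ t≡K → <⇒≢ K<t (sym t≡K))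
    -- Q(K) = K would make Q fix [0, K], forcing Q(K+1) < K to be its own preimage.
    K<QK : K < Q K
    K<QK = ≤∧≢⇒< (ascending-lower below z≤n z≤n ≤-refl) K≢QK
      where
      K≢QK : K ≢ Q K
      K≢QK K≡QK = <⇒≱ j<K (≤-trans (n≤1+n K) (≤-reflexive (sym j≡1+K)))
        where
        j = Q (suc K)
        j<K : j < K
        j<K = subst (j <_) (sym K≡QK) desc
        j≡1+K : j ≡ suc K
        j≡1+K = injective (≤-trans (<⇒≤ j<K) (<⇒≤ K<m)) K<m
          (ascending-fixes below z≤n (≤-reflexive (sym K≡QK)) z≤n (<⇒≤ j<K))
    -- Q(K+1) = K+1 would make Q fix [K+1, m], forcing Q(K) > K+1 to be its own preimage.
    Q[1+K]<1+K : Q (suc K) < suc K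
    Q[1+K]<1+K = ≤∧≢⇒< (ascending-upper above (bounded m ≤-refl) ≤-refl K<m) Q[1+K]≢1+K
      where
      Q[1+K]≢1+K : Q (suc K) ≢ suc K
      Q[1+K]≢1+K Q[1+K]≡1+K = <⇒≱ 1+K<j (≤-trans (≤-reflexive j≡K) (n≤1+n K))
        where
        j = Q K
        1+K<j : suc K < j
        1+K<j = subst (_< j) Q[1+K]≡1+K desc
        j≡K : j ≡ K
        j≡K = injective (bounded K (<⇒≤ K<m)) (<⇒≤ K<m)
          (ascending-fixes above (≤-reflexive (sym Q[1+K]≡1+K)) (bounded m ≤-refl)
             (<⇒≤ 1+K<j) (bounded K (<⇒≤ K<m)))

  admissible-descent :
    (∀ j → j ≤ m → Q j ≡ j) ⊎
    Σ ℕ (λ j → j < m × Q (suc j) < Q j × (j ≢ K ⊎ (j ≡ K × Q (suc K) ≤ K × K < Q K)))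
  admissible-descent with anyUpTo? (λ j → ¬? (j ≟ K) ×-dec (Q (suc j) <? Q j)) m
  ... | yes (j , j<m , j≢K , desc) = inj₂ (j , j<m , desc , inj₁ j≢K)
  ... | no none with Q (suc K) <? Q K
  ...   | yes desc = inj₂ (K , K<m , desc , inj₂ (refl , lone-descent-straddles off-K desc))
    where
    off-K : ∀ t → t < m → t ≢ K → Q t < Q (suc t)
    off-K t t<m t≢K = ascends t t<m (λ d → none (t , t<m , t≢K , d))
  ...   | no ¬desc = inj₁ (λ j j≤m → ascending-fixes everywhere z≤n (bounded m ≤-refl) z≤n j≤m)
    where
    everywhere : Ascending Q 0 m
    everywhere t _ t<m with t ≟ K
    ... | yes refl = ascends t t<m ¬desc
    ... | no t≢K = ascends t t<m (λ d → none (t , t<m , t≢K , d))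

-- The embedding of ℕ into Fin (suc m) that sends every j ≥ m to m.
clamp : ∀ {m} → ℕ → Fin (suc m)
clamp {m} zero = fzero
clamp {zero} (suc j) = fzero
clamp {suc m} (suc j) = fsuc (clamp {m} j)

toℕ-clamp : ∀ {m} j → j ≤ m → toℕ (clamp {m} j) ≡ j
toℕ-clamp {m} zero _ = refl
toℕ-clamp {suc m} (suc j) (s≤s j≤m) = cong suc (toℕ-clamp {m} j j≤m)

clamp-toℕ : ∀ {m} (x : Fin (suc m)) → clamp (toℕ x) ≡ x
clamp-toℕ fzero = refl
clamp-toℕ {suc m} (fsuc x) = cong fsuc (clamp-toℕ x)

Descent : ∀ {m} → Permutation′ (suc m) → Fin m → Set
Descent π i = toℕ (π ⟨$⟩ˡ fsuc i) < toℕ (π ⟨$⟩ˡ inject₁ i)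

Straddles : ∀ {m} → Permutation′ (suc m) → Fin m → Set
Straddles π k = toℕ (π ⟨$⟩ˡ fsuc k) ≤ toℕ k × toℕ k < toℕ (π ⟨$⟩ˡ inject₁ k)

Admissible : ∀ {m} → Permutation′ (suc m) → Fin m → Fin m → Set
Admissible π k i = i ≢ k ⊎ (i ≡ k × Straddles π k)

-- Every permutation other than the identity has an admissible descent; this
-- is admissible-descent applied to the positions j ↦ π⁻¹(j) of the values.
module _ {m : ℕ} (π : Permutation′ (suc m)) (k : Fin m) where
  private
    P : Fin (suc m) → Fin (suc m)
    P = π ⟨$⟩ˡ_

    Q : ℕ → ℕ
    Q j = toℕ (P (clamp j))

    P-injective : ∀ {x y} → P x ≡ P y → x ≡ y
    P-injective Px≡Py = trans (sym (inverseʳ π)) (trans (cong (π ⟨$⟩ʳ_) Px≡Py) (inverseʳ π))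

    Q-injective : ∀ {i j} → i ≤ m → j ≤ m → Q i ≡ Q j → i ≡ j
    Q-injective {i} {j} i≤m j≤m Qi≡Qj = begin
      i              ≡⟨ toℕ-clamp i i≤m ⟨
      toℕ (clamp i)  ≡⟨ cong toℕ (P-injective (toℕ-injective Qi≡Qj)) ⟩
      toℕ (clamp j)  ≡⟨ toℕ-clamp j j≤m ⟩
      j              ∎
      where open ≡-Reasoning

    Q-at-inject : ∀ i → Q (toℕ i) ≡ toℕ (P (inject₁ i))
    Q-at-inject i = trans (cong Q (sym (toℕ-inject₁ i))) (cong (toℕ ∘ P) (clamp-toℕ (inject₁ i)))

    Q-at-suc : ∀ i → Q (suc (toℕ i)) ≡ toℕ (P (fsuc i))
    Q-at-suc i = cong (toℕ ∘ P) (clamp-toℕ (fsuc i))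

    descent-at : ∀ i → Q (suc (toℕ i)) < Q (toℕ i) → Descent π i
    descent-at i = subst₂ _<_ (Q-at-suc i) (Q-at-inject i)

  identity-or-admissible-descent :
    (∀ x → π ⟨$⟩ʳ x ≡ x) ⊎ Σ (Fin m) (λ i → Descent π i × Admissible π k i)
  identity-or-admissible-descent
    with admissible-descent Q (toℕ<n k) (λ j _ → s≤s⁻¹ (toℕ<n (P (clamp j)))) Q-injective
  ... | inj₁ Q≗id = inj₁ (λ x → trans (sym (P-fixes (π ⟨$⟩ʳ x))) (inverseˡ π))
    where
    P-fixes : ∀ x → P x ≡ x
    P-fixes x = toℕ-injective (trans (cong (toℕ ∘ P) (sym (clamp-toℕ x)))
                                     (Q≗id (toℕ x) (s≤s⁻¹ (toℕ<n x))))
  ... | inj₂ (j , j<m , desc , inj₁ j≢K) = inj₂ (i , descent-at i desc′ , inj₁ i≢k)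
    where
    i = fromℕ< j<m
    desc′ : Q (suc (toℕ i)) < Q (toℕ i)
    desc′ = subst (λ t → Q (suc t) < Q t) (sym (toℕ-fromℕ< j<m)) desc
    i≢k : i ≢ k
    i≢k i≡k = j≢K (trans (sym (toℕ-fromℕ< j<m)) (cong toℕ i≡k))
  ... | inj₂ (_ , _ , desc , inj₂ (refl , Q[1+K]≤K , K<QK)) =
    inj₂ (k , descent-at k desc , inj₂ (refl , straddles))
    where
    straddles : Straddles π k
    straddles = subst (_≤ toℕ k) (Q-at-suc k) Q[1+K]≤K , subst (toℕ k <_) (Q-at-inject k) K<QK

crossings-admissible : ∀ {m} (π : Permutation′ (suc m)) (k i : Fin m) → Admissible π k i →
  𝟙[ i ≟ᶠ k ] + crossings k (σ i ∘ (π ⟨$⟩ʳ_)) ≡ crossings k (π ⟨$⟩ʳ_)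
crossings-admissible π k i (inj₁ i≢k) =
  trans (cong (_+ crossings k (σ i ∘ (π ⟨$⟩ʳ_))) (𝟙-no (i ≟ᶠ k) i≢k))
        (crossings-other k i i≢k (π ⟨$⟩ʳ_))
crossings-admissible π k i (inj₂ (refl , value[1+k]≤k , k<value[k])) =
  trans (cong (_+ crossings k (σ k ∘ (π ⟨$⟩ʳ_))) (𝟙-yes (k ≟ᶠ k) refl))
        (sym (balance-exact (crossings-step k π)
                (𝟙-no (toℕ (π ⟨$⟩ˡ inject₁ k) <? suc (toℕ k)) (<⇒≱ k<value[k] ∘ s≤s⁻¹))
                (𝟙-yes (toℕ (π ⟨$⟩ˡ fsuc k) <? suc (toℕ k)) (s≤s value[1+k]≤k))))

module _ {m : ℕ} (k : Fin m) where

  Economical : Permutation′ (suc m) → ℕ → Word m → Set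
  Economical π n ws = Represents π ws × length ws ≤ n × occ k ws ≤ crossings k (π ⟨$⟩ʳ_)

  identity-economical : ∀ {π n} → (∀ x → π ⟨$⟩ʳ x ≡ x) → Σ (Word m) (Economical π n)
  identity-economical π≗id = [] , (λ x → sym (π≗id x)) , z≤n , z≤n

  prepend : ∀ {π n ws} i → Admissible π k i →
            Economical (π ∘ₚ reflection i) n ws → Economical π (suc n) (i ∷ ws)
  prepend {π} {n} {ws} i admissible (represents , length≤n , occ≤) =
    represents′ , s≤s length≤n , occ≤′
    where
    represents′ : Represents π (i ∷ ws)
    represents′ x = trans (cong (σ i) (represents x)) (σ-involutive i (π ⟨$⟩ʳ x))
    occ≤′ : occ k (i ∷ ws) ≤ crossings k (π ⟨$⟩ʳ_)
    occ≤′ = begin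
      occ k (i ∷ ws)                               ≡⟨ occ-cons k i ws ⟩
      𝟙[ i ≟ᶠ k ] + occ k ws                       ≤⟨ +-monoʳ-≤ 𝟙[ i ≟ᶠ k ] occ≤ ⟩
      𝟙[ i ≟ᶠ k ] + crossings k (σ i ∘ (π ⟨$⟩ʳ_))  ≡⟨ crossings-admissible π k i admissible ⟩
      crossings k (π ⟨$⟩ʳ_)                        ∎
      where open ≤-Reasoning

  -- Peeling admissible descents: each lowers the inversion number by one.
  economical : ∀ n π → inversions (π ⟨$⟩ʳ_) ≡ n → Σ (Word m) (Economical π n)
  economical zero π inv≡0 with identity-or-admissible-descent π k
  ... | inj₁ π≗id = identity-economical {π} {zero} π≗id
  ... | inj₂ (i , desc , _) =
    ⊥-elim (1+n≢0 (trans (sym (inversions-descent π i desc)) inv≡0))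
  economical (suc n) π inv≡1+n with identity-or-admissible-descent π k
  ... | inj₁ π≗id = identity-economical {π} {suc n} π≗id
  ... | inj₂ (i , desc , admissible)
    with economical n (π ∘ₚ reflection i)
                    (suc-injective (trans (sym (inversions-descent π i desc)) inv≡1+n))
  ...   | ws , eco = i ∷ ws , prepend {π} {n} {ws} i admissible eco

crossCount≡crossings : ∀ {m} (w : Permutation′ (suc m)) (k : Fin m) →
  crossCount w k ≡ crossings k (w ⟨$⟩ʳ_)
crossCount≡crossings w k = trans (count-tabulate crosses? (λ x → x))
  (sum-cong-≗ (λ x → 𝟙-× (toℕ x <? suc (toℕ k)) (suc (toℕ k) ≤? toℕ (w ⟨$⟩ʳ x))))
  where
  crosses? : Decidable (λ j → toℕ j < suc (toℕ k) × suc (toℕ k) ≤ toℕ (w ⟨$⟩ʳ j))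
  crosses? j = (toℕ j <? suc (toℕ k)) ×-dec (suc (toℕ k) ≤? toℕ (w ⟨$⟩ʳ j))

theorem2p2 : (m : ℕ) → 2 ≤ suc m → (w : Permutation′ (suc m)) → (k : Fin m) →
    IsMinK w k (crossCount w k)
theorem2p2 m _ w k with economical k (inversions (w ⟨$⟩ʳ_)) w refl
... | ws , represents , length≤inv , occ≤crossings =
  (ws , (represents , shortest) , ≤-antisym occ≤crossCount (lower-bound ws represents)) ,
  λ vs reduced → lower-bound vs (proj₁ reduced)
  where
  lower-bound : ∀ vs → Represents w vs → crossCount w k ≤ occ k vs
  lower-bound vs rep =
    subst (_≤ occ k vs) (sym (crossCount≡crossings w k)) (occ-lower-bound k {w} vs rep)
  shortest : ∀ vs → Represents w vs → length ws ≤ length vs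
  shortest vs rep = ≤-trans length≤inv (length-lower-bound {π = w} vs rep)
  occ≤crossCount : occ k ws ≤ crossCount w k
  occ≤crossCount = subst (occ k ws ≤_) (sym (crossCount≡crossings w k)) occ≤crossings
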